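{- Let $(\mu,k)$ be a spherical profile, i.e. $\sum_i\mu_i(i-2)=k-4$, with $k\ge2$. Then there exists a path-like square-tiled surface with profile $(\mu,k)$.
   Context: A square-tiled surface on $[n]$ is a triple $\tau=(\tau_R,\tau_G,\tau_B)$ of involutions of $[n]$ (fixed points allowed) with $\langle\tau_R,\tau_G,\tau_B\rangle$ transitive on $[n]$. Its profile is $(\mu,k)$ where $\mu=[1^{\mu_1},2^{\mu_2},\dots]$ is the cycle type of $\tau_R\tau_G\tau_B$ and $k$ is the total number of fixed points of $\tau_R,\tau_G,\tau_B$. The dual cubic graph $S^*(\tau)$ has vertex set $[n]$, a colour-$c$ edge for each transposition of $\tau_c$ and a colour-$c$ half-edge at each fixed point of $\tau_c$. A $\{G,B\}$-component is an orbit of $\langle\tau_G,\tau_B\rangle$; in $S^*(\tau)$ it is a path or a cycle. $\tau$ is path-like if it has exactly one $\{G,B\}$-component and this component is a path. -}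

module Defs where

open import Data.Nat using (ℕ; zero; suc; _/_; _+_; _≤_)
open import Data.Unit using (⊤)
open import Data.Empty using (⊥)
open import Relation.Nullary using (yes; no)
open import Data.Integer as ℤ using (ℤ; +_)
open import Data.Fin using (Fin)
open import Data.Fin.Properties using (_≟_)
open import Data.List using (List; []; _∷_; length; filter; allFin; foldr)
open import Data.Product using (Σ; ∃; _×_; _,_)
open import Data.Sum using (_⊎_)
open import Relation.Binary.PropositionalEquality using (_≡_)
import Data.Nat.Properties as ℕP

Involution : (n : ℕ) → (Fin n → Fin n) → Set
Involution n τ = ∀ x → τ (τ x) ≡ x

-- A square-tiled surface: three involutions (fixed points allowed)
record Triple (n : ℕ) : Set where
  constructor triple
  field
    τR τG τB : Fin n → Fin n

data Colour : Set where
  R G B : Colour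

act : ∀ {n} → Triple n → Colour → Fin n → Fin n
act t R = Triple.τR t
act t G = Triple.τG t
act t B = Triple.τB t

-- apply a word of generators (rightmost letter applied first is irrelevant:
-- the monoid generated by involutions is the group they generate)
applyWord : ∀ {n} → Triple n → List Colour → Fin n → Fin n
applyWord t [] x = x
applyWord t (c ∷ w) x = act t c (applyWord t w x)

OnlyGB : List Colour → Set
OnlyGB [] = ⊤
OnlyGB (R ∷ w) = ⊥
OnlyGB (G ∷ w) = OnlyGB w
OnlyGB (B ∷ w) = OnlyGB w

Transitive : ∀ {n} → Triple n → Set
Transitive {n} t = ∀ (x y : Fin n) → ∃ λ w → applyWord t w x ≡ y

IsSquareTiled : (n : ℕ) → Triple n → Set
IsSquareTiled n t =
  Involution n (Triple.τR t) × Involution n (Triple.τG t) ×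
  Involution n (Triple.τB t) × Transitive t

product : ∀ {n} → Triple n → Fin n → Fin n
product t x = Triple.τR t (Triple.τG t (Triple.τB t x))

iter : ∀ {n} → (Fin n → Fin n) → ℕ → Fin n → Fin n
iter σ zero x = x
iter σ (suc m) x = σ (iter σ m x)

-- least m in {1,…,n} with σ^m x = x (0 if none; never happens for a permutation)
periodFrom : ∀ {n} → (Fin n → Fin n) → Fin n → ℕ → ℕ → ℕ
periodFrom σ x m zero = zero
periodFrom σ x m (suc fuel) with iter σ m x ≟ x
... | yes _ = m
... | no _ = periodFrom σ x (suc m) fuel

period : ∀ {n} → (Fin n → Fin n) → Fin n → ℕ
period {n} σ x = periodFrom σ x 1 n

pointsOnCyclesOfLength : ∀ {n} → (Fin n → Fin n) → ℕ → ℕ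
pointsOnCyclesOfLength {n} σ i = length (filter (λ x → period σ x ℕP.≟ i) (allFin n))

-- number of cycles of σ of length (suc i)
cyclesOfLength : ∀ {n} → (Fin n → Fin n) → ℕ → ℕ
cyclesOfLength σ i = pointsOnCyclesOfLength σ (suc i) / suc i

fixedPoints : ∀ {n} → (Fin n → Fin n) → ℕ
fixedPoints {n} τ = length (filter (λ x → τ x ≟ x) (allFin n))

totalFixed : ∀ {n} → Triple n → ℕ
totalFixed t = fixedPoints (Triple.τR t) + fixedPoints (Triple.τG t)
               + fixedPoints (Triple.τB t)

-- A cycle type μ = [1^{μ₁},2^{μ₂},…] is given by its list of multiplicities
-- (μ₁ ∷ μ₂ ∷ …); multiplicities beyond the end of the list are 0.
-- mult μ i = μ_{i+1}
mult : List ℕ → ℕ → ℕ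
mult [] i = 0
mult (m ∷ ms) zero = m
mult (m ∷ ms) (suc i) = mult ms i

HasProfile : ∀ {n} → Triple n → List ℕ → ℕ → Set
HasProfile t μ k =
  (∀ i → cyclesOfLength (product t) i ≡ mult μ i) × totalFixed t ≡ k

sphSumFrom : ℕ → List ℕ → ℤ
sphSumFrom i [] = + 0
sphSumFrom i (m ∷ ms) = (+ m) ℤ.* ((+ i) ℤ.- (+ 2)) ℤ.+ sphSumFrom (suc i) ms

sphSum : List ℕ → ℤ
sphSum μ = sphSumFrom 1 μ

Spherical : List ℕ → ℕ → Set
Spherical μ k = sphSum μ ≡ (+ k) ℤ.- (+ 4)

NonemptyType : List ℕ → Set
NonemptyType μ = ∃ λ i → 1 ≤ mult μ i

OneGBComponent : ∀ {n} → Triple n → Set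
OneGBComponent {n} t = ∀ (x y : Fin n) → ∃ λ w → OnlyGB w × applyWord t w x ≡ y

-- In S*(τ) every vertex carries exactly one G-slot and one B-slot (edge or
-- half-edge); a {G,B}-component is a cycle iff all these slots are full
-- edges, and a path iff it contains a half-edge, i.e. a fixed point of τG or τB.
GBComponentIsPath : ∀ {n} → Triple n → Set
GBComponentIsPath {n} t = ∃ λ (x : Fin n) → Triple.τG t x ≡ x ⊎ Triple.τB t x ≡ x

PathLike : ∀ {n} → Triple n → Set
PathLike t = OneGBComponent t × GBComponentIsPath t

{-# OPTIONS --safe #-}
module Submission where

open import Defs
open import Data.Nat using (ℕ; _≤_)
open import Data.List using (List)
open import Data.Product using (Σ; ∃; _×_)

open import Data.Nat as ℕ using (zero; suc; _+_; _*_; _∸_; _<_; _/_; _%_; z≤n; s≤s; NonZero; ⌊_/2⌋)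
open import Data.Nat.Properties as ℕ using (+-assoc; +-comm; +-suc; +-identityʳ; n≡⌊n+n/2⌋; n≡⌈n+n/2⌉)
open import Data.Nat.DivMod using (m<n⇒m%n≡m; n%n≡0; [m+n]%n≡m%n; %-distribˡ-+; m%n%n≡m%n; m*n/n≡m)
open import Data.Nat.ListAction using (sum)
open import Data.Nat.ListAction.Properties using (sum-++; sum-↭)
open import Algebra.Properties.CommutativeSemigroup ℕ.+-commutativeSemigroup using (x∙yz≈y∙xz)
open import Data.Integer as ℤ using (ℤ)
import Data.Integer.Properties as ℤ
import Data.Integer.Tactic.RingSolver as ℤ-Ring
open import Data.Fin as Fin
  using (Fin; zero; suc; toℕ; opposite; inject₁; fromℕ; fromℕ<; lower₁; _↑ˡ_; _↑ʳ_; splitAt)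
open import Data.Fin.Properties as Fin
  using (toℕ-injective; toℕ<n; toℕ-fromℕ; toℕ-fromℕ<; toℕ-inject₁; toℕ-lower₁; inject₁-lower₁;
         opposite-prop; opposite-involutive; toℕ-↑ˡ; toℕ-↑ʳ; splitAt-↑ˡ; splitAt-↑ʳ; splitAt⁻¹-↑ˡ;
         splitAt⁻¹-↑ʳ)
open import Data.List using ([]; _∷_; _++_; [_]; filter; length; map; replicate; tabulate; allFin)
open import Data.List.Properties
  using (filter-++; filter-accept; filter-reject; map-++; map-replicate; length-++; length-replicate)
open import Data.List.Relation.Binary.Permutation.Propositional
  using (_↭_; ↭-refl; ↭-sym; ↭-trans; ↭-reflexive; prep)
open import Data.List.Relation.Binary.Permutation.Propositional.Properties using (filter-↭; ∷↭∷ʳ; shift)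
open import Data.Product using (∃₂; _,_)
open import Data.Sum using (_⊎_; inj₁; inj₂; [_,_]′)
open import Data.Unit using (tt)
open import Data.Empty using (⊥; ⊥-elim)
open import Function using (_∘_; id)
open import Function.Definitions using (Injective)
open import Relation.Nullary using (Dec; yes; no; ¬_)
open import Relation.Unary using (Decidable)
open import Relation.Binary.PropositionalEquality hiding ([_])
open ≡-Reasoning

-- On Fin n, read as ℤ/n, take τ_B = opposite (x ↦ -1-x) and τ_G = neg (x ↦ -x). Then
-- τ_G τ_B = succ (x ↦ x+1), so ⟨τ_G, τ_B⟩ is transitive, and the two reflections have two
-- fixed points in total: the {G,B}-component is a single path. It remains to choose an
-- involution τ_R, i.e. a partial chord diagram on the n-gon, whose faces (the cycles of
-- τ_R ∘ succ) have the cycle type μ, with k - 2 unmatched points. Inserting a diagram D₂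
-- between two consecutive points of D₁ and joining an unmatched point of each by a new
-- chord keeps every face of D₁ and of D₂ and uses up two unmatched points. Starting from
-- chordless polygons (one face, all points unmatched), chains of insertions realise any
-- list of face lengths c₁, …, c_m with 2 + Σ (cᵢ - 2) ≥ 0 unmatched points; for the cycle
-- type μ this number is k - 2 exactly by the spherical condition.

-- Counting points of Fin n

indicator : ∀ {A : Set} → Dec A → ℕ
indicator (yes _) = 1
indicator (no _)  = 0

count : ∀ n {P : Fin n → Set} → Decidable P → ℕ
count zero    P? = 0
count (suc n) P? = indicator (P? zero) + count n (P? ∘ suc)

length-filter-tabulate : ∀ {A : Set} {P : A → Set} (P? : Decidable P) n (f : Fin n → A) →
  length (filter P? (tabulate f)) ≡ count n (P? ∘ f)
length-filter-tabulate P? zero    f = refl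
length-filter-tabulate P? (suc n) f with P? (f zero)
... | yes _ = cong suc (length-filter-tabulate P? n (f ∘ suc))
... | no _  = length-filter-tabulate P? n (f ∘ suc)

length-filter-allFin : ∀ n {P : Fin n → Set} (P? : Decidable P) →
  length (filter P? (allFin n)) ≡ count n P?
length-filter-allFin n P? = length-filter-tabulate P? n id

indicator-cong : ∀ {A B : Set} (a : Dec A) (b : Dec B) → (A → B) → (B → A) →
  indicator a ≡ indicator b
indicator-cong (yes _) (yes _) _ _ = refl
indicator-cong (yes a) (no ¬b) f _ = ⊥-elim (¬b (f a))
indicator-cong (no ¬a) (yes b) _ g = ⊥-elim (¬a (g b))
indicator-cong (no _)  (no _)  _ _ = refl

count-cong : ∀ n {P Q : Fin n → Set} (P? : Decidable P) (Q? : Decidable Q) →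
  (∀ x → P x → Q x) → (∀ x → Q x → P x) → count n P? ≡ count n Q?
count-cong zero    P? Q? f g = refl
count-cong (suc n) P? Q? f g =
  cong₂ _+_ (indicator-cong (P? zero) (Q? zero) (f zero) (g zero))
            (count-cong n (P? ∘ suc) (Q? ∘ suc) (f ∘ suc) (g ∘ suc))

count-∘-cong : ∀ n {k} {P : Fin k → Set} (P? : Decidable P) {f g : Fin n → Fin k} →
  (∀ x → f x ≡ g x) → count n (P? ∘ f) ≡ count n (P? ∘ g)
count-∘-cong n {P = P} P? f≗g =
  count-cong n _ _ (λ x → subst P (f≗g x)) (λ x → subst P (sym (f≗g x)))

count-level-cong : ∀ n {g h : Fin n → ℕ} → (∀ x → g x ≡ h x) → ∀ ℓ →
  count n (λ x → g x ℕ.≟ ℓ) ≡ count n (λ x → h x ℕ.≟ ℓ)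
count-level-cong n g≗h ℓ = count-cong n _ _ (λ x → trans (sym (g≗h x))) (λ x → trans (g≗h x))

count-+ : ∀ m n {P : Fin (m + n) → Set} (P? : Decidable P) →
  count (m + n) P? ≡ count m (P? ∘ (_↑ˡ n)) + count n (P? ∘ (m ↑ʳ_))
count-+ zero    n P? = refl
count-+ (suc m) n P? = trans (cong (indicator (P? zero) +_) (count-+ m n (P? ∘ suc)))
                             (sym (+-assoc (indicator (P? zero)) _ _))

count-all : ∀ n {P : Fin n → Set} (P? : Decidable P) → (∀ x → P x) → count n P? ≡ n
count-all zero    P? all = refl
count-all (suc n) P? all with P? zero
... | yes _ = cong suc (count-all n (P? ∘ suc) (all ∘ suc))
... | no ¬p = ⊥-elim (¬p (all zero))

count-none : ∀ n {P : Fin n → Set} (P? : Decidable P) → (∀ x → ¬ P x) → count n P? ≡ 0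
count-none zero    P? none = refl
count-none (suc n) P? none with P? zero
... | yes p = ⊥-elim (none zero p)
... | no _  = count-none n (P? ∘ suc) (none ∘ suc)

count-except : ∀ n {P Q : Fin n → Set} (P? : Decidable P) (Q? : Decidable Q) (a : Fin n) →
  P a → ¬ Q a → (∀ x → x ≢ a → P x → Q x) → (∀ x → x ≢ a → Q x → P x) →
  count n P? ≡ suc (count n Q?)
count-except (suc n) P? Q? zero pa ¬qa f g with P? zero | Q? zero
... | _     | yes qa = ⊥-elim (¬qa qa)
... | no ¬p | _      = ⊥-elim (¬p pa)
... | yes _ | no _   = cong suc (count-cong n (P? ∘ suc) (Q? ∘ suc)
                         (λ x → f (suc x) λ ()) (λ x → g (suc x) λ ()))
count-except (suc n) P? Q? (suc a) pa ¬qa f g =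
  trans (cong₂ _+_ (indicator-cong (P? zero) (Q? zero) (f zero λ ()) (g zero λ ()))
                   (count-except n (P? ∘ suc) (Q? ∘ suc) a pa ¬qa
                      (λ x x≢a → f (suc x) (x≢a ∘ Fin.suc-injective))
                      (λ x x≢a → g (suc x) (x≢a ∘ Fin.suc-injective))))
        (+-suc (indicator (Q? zero)) _)

count-unique : ∀ n {P : Fin n → Set} (P? : Decidable P) (a : Fin n) →
  P a → (∀ x → P x → x ≡ a) → count n P? ≡ 1
count-unique n P? a pa unique =
  trans (count-except n P? never a pa (λ ()) (λ x x≢a px → x≢a (unique x px)) (λ _ _ ()))
        (cong suc (count-none n never (λ _ ())))
  where
  never : Decidable {A = Fin n} (λ _ → ⊥)
  never _ = no λ ()

-- Rotation and reflections of Fin n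

neg : ∀ {n} → Fin n → Fin n
neg zero    = zero
neg (suc i) = suc (opposite i)

-- Defined through the two reflections so that τ_R τ_G τ_B = τ_R ∘ succ holds by definition.
succ : ∀ {n} → Fin n → Fin n
succ x = neg (opposite x)

neg-involutive : ∀ {n} (x : Fin n) → neg (neg x) ≡ x
neg-involutive zero    = refl
neg-involutive (suc i) = cong suc (opposite-involutive i)

opposite-inject₁ : ∀ {n} (i : Fin n) → opposite (inject₁ i) ≡ suc (opposite i)
opposite-inject₁ {n} i = toℕ-injective (begin
  toℕ (opposite (inject₁ i))  ≡⟨ opposite-prop (inject₁ i) ⟩
  n ∸ toℕ (inject₁ i)         ≡⟨ cong (n ∸_) (toℕ-inject₁ i) ⟩
  suc n ∸ suc (toℕ i)         ≡⟨ ℕ.+-∸-assoc 1 (toℕ<n i) ⟩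
  suc (n ∸ suc (toℕ i))       ≡⟨ cong suc (opposite-prop i) ⟨
  toℕ (suc (opposite i))      ∎)

opposite-fromℕ : ∀ n → opposite (fromℕ n) ≡ zero
opposite-fromℕ zero    = refl
opposite-fromℕ (suc n) = cong inject₁ (opposite-fromℕ n)

succ-inject₁ : ∀ {n} (i : Fin n) → succ (inject₁ i) ≡ suc i
succ-inject₁ i = trans (cong neg (opposite-inject₁ i)) (cong suc (opposite-involutive i))

succ-fromℕ : ∀ n → succ (fromℕ n) ≡ zero
succ-fromℕ n = cong neg (opposite-fromℕ n)

toℕ-succ-< : ∀ {n} (x : Fin n) → suc (toℕ x) < n → toℕ (succ x) ≡ suc (toℕ x)
toℕ-succ-< {suc n} x sx<n = begin
  toℕ (succ x)                           ≡⟨ cong (toℕ ∘ succ) (inject₁-lower₁ x n≢x) ⟨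
  toℕ (succ (inject₁ (lower₁ x n≢x)))    ≡⟨ cong toℕ (succ-inject₁ (lower₁ x n≢x)) ⟩
  suc (toℕ (lower₁ x n≢x))               ≡⟨ cong suc (toℕ-lower₁ x n≢x) ⟩
  suc (toℕ x)                            ∎
  where
  n≢x : n ≢ toℕ x
  n≢x n≡x = ℕ.<-irrefl (cong suc (sym n≡x)) sx<n

toℕ-succ-last : ∀ {n} (x : Fin n) → suc (toℕ x) ≡ n → toℕ (succ x) ≡ 0
toℕ-succ-last {suc n} x last =
  cong toℕ (trans (cong succ (toℕ-injective (trans (ℕ.suc-injective last) (sym (toℕ-fromℕ n)))))
                  (succ-fromℕ n))

not-last-or-last : ∀ {n} (x : Fin n) → suc (toℕ x) < n ⊎ suc (toℕ x) ≡ n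
not-last-or-last x = ℕ.m≤n⇒m<n∨m≡n (toℕ<n x)

succ-step : ∀ {n} {x y : Fin n} → toℕ y ≡ suc (toℕ x) → succ x ≡ y
succ-step {x = x} {y} y≡sx =
  toℕ-injective (trans (toℕ-succ-< x (subst (_< _) y≡sx (toℕ<n y))) (sym y≡sx))

succ-wrap : ∀ {n} {x y : Fin n} → suc (toℕ x) ≡ n → toℕ y ≡ 0 → succ x ≡ y
succ-wrap {x = x} last y≡0 = toℕ-injective (trans (toℕ-succ-last x last) (sym y≡0))

toℕ-succ : ∀ {n} (x : Fin n) .{{_ : NonZero n}} → toℕ (succ x) ≡ suc (toℕ x) % n
toℕ-succ {n} x with not-last-or-last x
... | inj₁ sx<n = trans (toℕ-succ-< x sx<n) (sym (m<n⇒m%n≡m sx<n))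
... | inj₂ last = trans (toℕ-succ-last x last) (sym (trans (cong (_% n) last) (n%n≡0 n)))

[1+m%n]%n≡[1+m]%n : ∀ m n .{{_ : NonZero n}} → suc (m % n) % n ≡ suc m % n
[1+m%n]%n≡[1+m]%n m n = begin
  (1 + m % n) % n            ≡⟨ %-distribˡ-+ 1 (m % n) n ⟩
  (1 % n + m % n % n) % n    ≡⟨ cong (λ k → (1 % n + k) % n) (m%n%n≡m%n m n) ⟩
  (1 % n + m % n) % n        ≡⟨ %-distribˡ-+ 1 m n ⟨
  (1 + m) % n                ∎

toℕ-iter-succ : ∀ {n} .{{_ : NonZero n}} j (x : Fin n) → toℕ (iter succ j x) ≡ (toℕ x + j) % n
toℕ-iter-succ {n} zero    x = sym (trans (cong (_% n) (+-identityʳ (toℕ x))) (m<n⇒m%n≡m (toℕ<n x)))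
toℕ-iter-succ {n} (suc j) x = begin
  toℕ (succ (iter succ j x))       ≡⟨ toℕ-succ (iter succ j x) ⟩
  suc (toℕ (iter succ j x)) % n    ≡⟨ cong (λ k → suc k % n) (toℕ-iter-succ j x) ⟩
  suc ((toℕ x + j) % n) % n        ≡⟨ [1+m%n]%n≡[1+m]%n (toℕ x + j) n ⟩
  suc (toℕ x + j) % n              ≡⟨ cong (_% n) (+-suc (toℕ x) j) ⟨
  (toℕ x + suc j) % n              ∎

succ-reaches : ∀ {n} (x y : Fin (suc n)) → iter succ (suc n ∸ toℕ x + toℕ y) x ≡ y
succ-reaches {n} x y = toℕ-injective (begin
  toℕ (iter succ j x)                 ≡⟨ toℕ-iter-succ j x ⟩
  (toℕ x + (d + toℕ y)) % suc n       ≡⟨ cong (_% suc n) (+-assoc (toℕ x) d (toℕ y)) ⟨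
  (toℕ x + d + toℕ y) % suc n         ≡⟨ cong (λ k → (k + toℕ y) % suc n) (ℕ.m+[n∸m]≡n x≤n) ⟩
  (suc n + toℕ y) % suc n             ≡⟨ cong (_% suc n) (+-comm (suc n) (toℕ y)) ⟩
  (toℕ y + suc n) % suc n             ≡⟨ [m+n]%n≡m%n (toℕ y) (suc n) ⟩
  toℕ y % suc n                       ≡⟨ m<n⇒m%n≡m (toℕ<n y) ⟩
  toℕ y                               ∎)
  where
  d = suc n ∸ toℕ x
  j = d + toℕ y
  x≤n : toℕ x ≤ suc n
  x≤n = ℕ.<⇒≤ (toℕ<n x)

[m+j]%n≢m : ∀ {n m j} .{{_ : NonZero n}} → m < n → 0 < j → j < n → (m + j) % n ≢ m
[m+j]%n≢m {n} {m} {j} m<n 0<j j<n eq with m + j ℕ.<? n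
... | yes m+j<n = ℕ.<-irrefl (sym (trans (sym (m<n⇒m%n≡m m+j<n)) eq)) (ℕ.m<m+n m 0<j)
... | no m+j≮n  = ℕ.<-irrefl r≡m r<m
  where
  r = m + j ∸ n
  r+n≡m+j : r + n ≡ m + j
  r+n≡m+j = ℕ.m∸n+n≡m (ℕ.≮⇒≥ m+j≮n)
  r<m : r < m
  r<m = ℕ.+-cancelʳ-< n r m (subst (_< m + n) (sym r+n≡m+j) (ℕ.+-monoʳ-< m j<n))
  r≡m : r ≡ m
  r≡m = begin
    r             ≡⟨ m<n⇒m%n≡m (ℕ.<-trans r<m m<n) ⟨
    r % n         ≡⟨ [m+n]%n≡m%n r n ⟨
    (r + n) % n   ≡⟨ cong (_% n) r+n≡m+j ⟩
    (m + j) % n   ≡⟨ eq ⟩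
    m             ∎

even-or-odd : ∀ n → ∃ λ h → n ≡ h + h ⊎ n ≡ suc (h + h)
even-or-odd zero = 0 , inj₁ refl
even-or-odd (suc n) with even-or-odd n
... | h , inj₁ refl = h , inj₂ refl
... | h , inj₂ refl = suc h , inj₁ (cong suc (sym (+-suc h h)))

double-injective : ∀ {x y} → x + x ≡ y + y → x ≡ y
double-injective {x} {y} eq = trans (n≡⌊n+n/2⌋ x) (trans (cong ⌊_/2⌋ eq) (sym (n≡⌊n+n/2⌋ y)))

double≢suc-double : ∀ x y → x + x ≢ suc (y + y)
double≢suc-double x y eq = ℕ.1+n≢n (sym (trans eq (cong (λ z → suc (z + z)) (sym x≡y))))
  where
  x≡y : x ≡ y
  x≡y = trans (n≡⌊n+n/2⌋ x) (trans (cong ⌊_/2⌋ eq) (sym (n≡⌈n+n/2⌉ y)))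

opposite-fixed⇒ : ∀ {n} (x : Fin n) → opposite x ≡ x → suc (toℕ x + toℕ x) ≡ n
opposite-fixed⇒ {n} x fixed = begin
  suc (toℕ x + toℕ x)            ≡⟨ +-suc (toℕ x) (toℕ x) ⟨
  toℕ x + suc (toℕ x)            ≡⟨ cong (_+ suc (toℕ x)) x≡n∸sx ⟩
  n ∸ suc (toℕ x) + suc (toℕ x)  ≡⟨ ℕ.m∸n+n≡m (toℕ<n x) ⟩
  n                              ∎
  where
  x≡n∸sx : toℕ x ≡ n ∸ suc (toℕ x)
  x≡n∸sx = trans (sym (cong toℕ fixed)) (opposite-prop x)

opposite-fixed⇐ : ∀ {n} (x : Fin n) → suc (toℕ x + toℕ x) ≡ n → opposite x ≡ x
opposite-fixed⇐ {n} x centre = toℕ-injective (begin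
  toℕ (opposite x)                   ≡⟨ opposite-prop x ⟩
  n ∸ suc (toℕ x)                    ≡⟨ cong (_∸ suc (toℕ x)) centre ⟨
  suc (toℕ x + toℕ x) ∸ suc (toℕ x)  ≡⟨ ℕ.m+n∸n≡m (toℕ x) (toℕ x) ⟩
  toℕ x                              ∎)

oppositeFixed : ℕ → ℕ
oppositeFixed n = count n (λ x → opposite x Fin.≟ x)

oppositeFixed-even : ∀ h → oppositeFixed (h + h) ≡ 0
oppositeFixed-even h = count-none (h + h) (λ x → opposite x Fin.≟ x)
  λ x fixed → double≢suc-double h (toℕ x) (sym (opposite-fixed⇒ x fixed))

oppositeFixed-odd : ∀ h → oppositeFixed (suc (h + h)) ≡ 1
oppositeFixed-odd h = count-unique _ (λ x → opposite x Fin.≟ x) centre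
  (opposite-fixed⇐ centre (cong (λ k → suc (k + k)) toℕ-centre))
  λ x fixed → toℕ-injective (trans (double-injective (ℕ.suc-injective (opposite-fixed⇒ x fixed)))
                                    (sym toℕ-centre))
  where
  h<n : h < suc (h + h)
  h<n = s≤s (ℕ.m≤m+n h h)
  centre : Fin (suc (h + h))
  centre = fromℕ< h<n
  toℕ-centre : toℕ centre ≡ h
  toℕ-centre = toℕ-fromℕ< h<n

oppositeFixed-consecutive : ∀ n → oppositeFixed n + oppositeFixed (suc n) ≡ 1
oppositeFixed-consecutive n with even-or-odd n
... | h , inj₁ refl = cong₂ _+_ (oppositeFixed-even h) (oppositeFixed-odd h)
... | h , inj₂ refl = cong₂ _+_ (oppositeFixed-odd h)
        (trans (cong oppositeFixed (cong suc (sym (+-suc h h)))) (oppositeFixed-even (suc h)))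

negFixed : ∀ n → count (suc n) (λ x → neg x Fin.≟ x) ≡ suc (oppositeFixed n)
negFixed n = cong suc (count-cong n _ _ (λ _ → Fin.suc-injective) (λ _ → cong suc))

negFixed+oppositeFixed : ∀ n → count (suc n) (λ x → neg x Fin.≟ x) + oppositeFixed (suc n) ≡ 2
negFixed+oppositeFixed n =
  cong suc (trans (cong (_+ oppositeFixed (suc n)) (ℕ.suc-injective (negFixed n)))
                  (oppositeFixed-consecutive n))

-- Periods

record IsPeriod {n} (σ : Fin n → Fin n) (x : Fin n) (L : ℕ) : Set where
  field
    positive : 0 < L
    bounded  : L ≤ n
    returns  : iter σ L x ≡ x
    minimal  : ∀ {j} → 0 < j → j < L → iter σ j x ≢ x

periodFrom-first-return : ∀ {n} (σ : Fin n → Fin n) x {L} start fuel →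
  start ≤ L → L < start + fuel → (∀ {j} → start ≤ j → j < L → iter σ j x ≢ x) → iter σ L x ≡ x →
  periodFrom σ x start fuel ≡ L
periodFrom-first-return σ x {L} start zero start≤L L<start _ _ =
  ⊥-elim (ℕ.<⇒≱ (subst (L <_) (+-identityʳ start) L<start) start≤L)
periodFrom-first-return σ x start (suc fuel) start≤L L<end early back with iter σ start x Fin.≟ x
... | yes start-back with ℕ.m≤n⇒m<n∨m≡n start≤L
...   | inj₁ start<L = ⊥-elim (early ℕ.≤-refl start<L start-back)
...   | inj₂ start≡L = start≡L
periodFrom-first-return σ x {L} start (suc fuel) start≤L L<end early back | no start-away =
  periodFrom-first-return σ x (suc start) fuel
    (ℕ.≤∧≢⇒< start≤L λ { refl → start-away back })
    (subst (L <_) (+-suc start fuel) L<end) (early ∘ ℕ.<⇒≤) back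

IsPeriod⇒period≡ : ∀ {n} {σ : Fin n → Fin n} {x L} → IsPeriod σ x L → period σ x ≡ L
IsPeriod⇒period≡ {σ = σ} {x} P =
  periodFrom-first-return σ x 1 _ positive (s≤s bounded) minimal returns
  where open IsPeriod P

iter-equivariant : ∀ {m n} {σ : Fin m → Fin m} {τ : Fin n → Fin n} (e : Fin m → Fin n) →
  (∀ x → τ (e x) ≡ e (σ x)) → ∀ j x → iter τ j (e x) ≡ e (iter σ j x)
iter-equivariant           e comm zero    x = refl
iter-equivariant {τ = τ} e comm (suc j) x = trans (cong τ (iter-equivariant e comm j x)) (comm _)

IsPeriod-equivariant : ∀ {m n} {σ : Fin m → Fin m} {τ : Fin n → Fin n} {x L} (e : Fin m → Fin n) →
  Injective _≡_ _≡_ e → (∀ x → τ (e x) ≡ e (σ x)) → m ≤ n →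
  IsPeriod σ x L → IsPeriod τ (e x) L
IsPeriod-equivariant {τ = τ} {x} {L} e e-injective comm m≤n P = record
  { positive = positive
  ; bounded  = ℕ.≤-trans bounded m≤n
  ; returns  = trans (iter-equivariant e comm L x) (cong e returns)
  ; minimal  = λ {j} 0<j j<L back →
      minimal 0<j j<L (e-injective (trans (sym (iter-equivariant {τ = τ} e comm j x)) back))
  }
  where open IsPeriod P

period-equivariant : ∀ {m n} {σ : Fin m → Fin m} {τ : Fin n → Fin n} {x} (e : Fin m → Fin n) →
  Injective _≡_ _≡_ e → (∀ x → τ (e x) ≡ e (σ x)) → m ≤ n → ∃ (IsPeriod σ x) →
  period τ (e x) ≡ period σ x
period-equivariant e e-injective comm m≤n (L , P) =
  trans (IsPeriod⇒period≡ (IsPeriod-equivariant e e-injective comm m≤n P))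
        (sym (IsPeriod⇒period≡ P))

succ-IsPeriod : ∀ {n} (x : Fin (suc n)) → IsPeriod succ x (suc n)
succ-IsPeriod {n} x = record
  { positive = s≤s z≤n
  ; bounded  = ℕ.≤-refl
  ; returns  = toℕ-injective (begin
      toℕ (iter succ (suc n) x)    ≡⟨ toℕ-iter-succ (suc n) x ⟩
      (toℕ x + suc n) % suc n      ≡⟨ [m+n]%n≡m%n (toℕ x) (suc n) ⟩
      toℕ x % suc n                ≡⟨ m<n⇒m%n≡m (toℕ<n x) ⟩
      toℕ x                        ∎)
  ; minimal  = λ {j} 0<j j<n back →
      [m+j]%n≢m (toℕ<n x) 0<j j<n (trans (sym (toℕ-iter-succ j x)) (cong toℕ back))
  }

-- Chord diagrams

pointsOn : List ℕ → ℕ → ℕ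
pointsOn cs ℓ = sum (filter (ℕ._≟ ℓ) cs)

pointsOn-++ : ∀ xs ys ℓ → pointsOn (xs ++ ys) ℓ ≡ pointsOn xs ℓ + pointsOn ys ℓ
pointsOn-++ xs ys ℓ = trans (cong sum (filter-++ (ℕ._≟ ℓ) xs ys)) (sum-++ (filter _ xs) _)

pointsOn-here : ∀ {c} cs {ℓ} → c ≡ ℓ → pointsOn (c ∷ cs) ℓ ≡ c + pointsOn cs ℓ
pointsOn-here cs {ℓ} c≡ℓ = cong sum (filter-accept (ℕ._≟ ℓ) {xs = cs} c≡ℓ)

pointsOn-there : ∀ {c} cs {ℓ} → c ≢ ℓ → pointsOn (c ∷ cs) ℓ ≡ pointsOn cs ℓ
pointsOn-there cs {ℓ} c≢ℓ = cong sum (filter-reject (ℕ._≟ ℓ) {xs = cs} c≢ℓ)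

pointsOn-↭ : ∀ {xs ys} → xs ↭ ys → ∀ ℓ → pointsOn xs ℓ ≡ pointsOn ys ℓ
pointsOn-↭ xs↭ys ℓ = sum-↭ (filter-↭ (ℕ._≟ ℓ) xs↭ys)

-- The points of Fin n sit on a circle in the order given by succ and chord is a partial
-- matching of them; the faces of the diagram are the cycles of chord ∘ succ.
record ChordDiagram (n f : ℕ) (cs : List ℕ) (r : ℕ) : Set where
  field
    chord            : Fin n → Fin n
    chord-involutive : ∀ x → chord (chord x) ≡ x
    prefix≤n         : r ≤ n
    prefix-unmatched : ∀ x → toℕ x < r → chord x ≡ x
    faces-periodic   : ∀ x → ∃ (IsPeriod (chord ∘ succ) x)
    unmatched        : count n (λ x → chord x Fin.≟ x) ≡ f
    census           : ∀ ℓ → count n (λ x → period (chord ∘ succ) x ℕ.≟ ℓ) ≡ pointsOn cs ℓ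

Diagram : ℕ → List ℕ → ℕ → Set
Diagram f cs r = ∃ λ n → ChordDiagram (suc n) f cs r

resize : ∀ {n n′ f cs r} → n ≡ n′ → ChordDiagram n f cs r → ChordDiagram n′ f cs r
resize refl D = D

retype : ∀ {f f′ cs cs′ r r′} → f ≡ f′ → cs ↭ cs′ → r′ ≤ r → Diagram f cs r → Diagram f′ cs′ r′
retype refl cs↭cs′ r′≤r (n , D) = n , record
  { chord            = chord
  ; chord-involutive = chord-involutive
  ; prefix≤n         = ℕ.≤-trans r′≤r prefix≤n
  ; prefix-unmatched = λ x x<r′ → prefix-unmatched x (ℕ.<-≤-trans x<r′ r′≤r)
  ; faces-periodic   = faces-periodic
  ; unmatched        = unmatched
  ; census           = λ ℓ → trans (census ℓ) (pointsOn-↭ cs↭cs′ ℓ)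
  }
  where open ChordDiagram D

polygon : ∀ n → ChordDiagram (suc n) (suc n) [ suc n ] (suc n)
polygon n = record
  { chord            = id
  ; chord-involutive = λ _ → refl
  ; prefix≤n         = ℕ.≤-refl
  ; prefix-unmatched = λ _ _ → refl
  ; faces-periodic   = λ x → suc n , succ-IsPeriod x
  ; unmatched        = count-all (suc n) (λ x → x Fin.≟ x) (λ _ → refl)
  ; census           = census
  }
  where
  period-succ : ∀ x → period succ x ≡ suc n
  period-succ x = IsPeriod⇒period≡ (succ-IsPeriod x)
  census : ∀ ℓ → count (suc n) (λ x → period succ x ℕ.≟ ℓ) ≡ pointsOn [ suc n ] ℓ
  census ℓ with suc n ℕ.≟ ℓ
  ... | yes n≡ℓ = begin
    count (suc n) (λ x → period succ x ℕ.≟ ℓ)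
      ≡⟨ count-all (suc n) (λ x → period succ x ℕ.≟ ℓ) (λ x → trans (period-succ x) n≡ℓ) ⟩
    suc n
      ≡⟨ trans (pointsOn-here [] n≡ℓ) (+-identityʳ (suc n)) ⟨
    pointsOn [ suc n ] ℓ ∎
  ... | no n≢ℓ = begin
    count (suc n) (λ x → period succ x ℕ.≟ ℓ)
      ≡⟨ count-none (suc n) (λ x → period succ x ℕ.≟ ℓ) (λ x → n≢ℓ ∘ trans (sym (period-succ x))) ⟩
    0
      ≡⟨ pointsOn-there [] n≢ℓ ⟨
    pointsOn [ suc n ] ℓ ∎

leaf : Diagram 1 [ 1 ] 1
leaf = 0 , polygon 0

-- Inserting one chord diagram into another

data Split (u v : ℕ) : Fin (u + v) → Set where
  left  : (i : Fin u) → Split u v (i ↑ˡ v)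
  right : (j : Fin v) → Split u v (u ↑ʳ j)

split : ∀ u v (x : Fin (u + v)) → Split u v x
split u v x with splitAt u x in eq
... | inj₁ i = subst (Split u v) (splitAt⁻¹-↑ˡ eq) (left i)
... | inj₂ j = subst (Split u v) (splitAt⁻¹-↑ʳ eq) (right j)

-- Fin N lists the first a points of Fin (a + suc q), then the suc m inserted points, then
-- the last suc q points of Fin (a + suc q); the pivot is the first point after the gap.
module Layout (a q m : ℕ) where

  N : ℕ
  N = a + (suc m + suc q)

  outer : Fin (a + suc q) → Fin N
  outer x = [ _↑ˡ (suc m + suc q) , (λ j → a ↑ʳ (suc m ↑ʳ j)) ]′ (splitAt a x)

  inner : Fin (suc m) → Fin N
  inner k = a ↑ʳ (k ↑ˡ suc q)

  pivot : Fin (a + suc q)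
  pivot = a ↑ʳ zero

  part : Fin N → Fin (a + suc q) ⊎ Fin (suc m)
  part y = [ (λ i → inj₁ (i ↑ˡ suc q))
           , (λ z → [ inj₂ , (λ j → inj₁ (a ↑ʳ j)) ]′ (splitAt (suc m) z)) ]′ (splitAt a y)

  outer-↑ˡ : ∀ i → outer (i ↑ˡ suc q) ≡ i ↑ˡ (suc m + suc q)
  outer-↑ˡ i rewrite splitAt-↑ˡ a i (suc q) = refl

  outer-↑ʳ : ∀ j → outer (a ↑ʳ j) ≡ a ↑ʳ (suc m ↑ʳ j)
  outer-↑ʳ j rewrite splitAt-↑ʳ a (suc q) j = refl

  part-outer : ∀ x → part (outer x) ≡ inj₁ x
  part-outer x with split a (suc q) x
  ... | left i  rewrite outer-↑ˡ i | splitAt-↑ˡ a i (suc m + suc q) = refl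
  ... | right j rewrite outer-↑ʳ j | splitAt-↑ʳ a (suc m + suc q) (suc m ↑ʳ j)
                      | splitAt-↑ʳ (suc m) (suc q) j = refl

  part-inner : ∀ k → part (inner k) ≡ inj₂ k
  part-inner k rewrite splitAt-↑ʳ a (suc m + suc q) (k ↑ˡ suc q) | splitAt-↑ˡ (suc m) k (suc q) = refl

  outer-injective : Injective _≡_ _≡_ outer
  outer-injective {x} {y} eq with trans (sym (part-outer x)) (trans (cong part eq) (part-outer y))
  ... | refl = refl

  inner-injective : Injective _≡_ _≡_ inner
  inner-injective {k} {l} eq with trans (sym (part-inner k)) (trans (cong part eq) (part-inner l))
  ... | refl = refl

  outer≢inner : ∀ x k → outer x ≢ inner k
  outer≢inner x k eq with trans (sym (part-outer x)) (trans (cong part eq) (part-inner k))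
  ... | ()

  data Side : Fin N → Set where
    outerˢ : ∀ x → Side (outer x)
    innerˢ : ∀ k → Side (inner k)

  side : ∀ y → Side y
  side y with split a (suc m + suc q) y
  ... | left i  = subst Side (outer-↑ˡ i) (outerˢ (i ↑ˡ suc q))
  ... | right z with split (suc m) (suc q) z
  ...   | left k  = innerˢ k
  ...   | right j = subst Side (outer-↑ʳ j) (outerˢ (a ↑ʳ j))

  count-split : ∀ {P : Fin N → Set} (P? : Decidable P) →
    count N P? ≡ count (a + suc q) (P? ∘ outer) + count (suc m) (P? ∘ inner)
  count-split P? = begin
    count N P?                                     ≡⟨ count-+ a (suc m + suc q) P? ⟩
    #left + count (suc m + suc q) (P? ∘ (a ↑ʳ_))   ≡⟨ cong (#left +_) #middle ⟩
    #left + (#inner + #right)                      ≡⟨ cong (#left +_) (+-comm #inner #right) ⟩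
    #left + (#right + #inner)                      ≡⟨ +-assoc #left #right #inner ⟨
    #left + #right + #inner                        ≡⟨ cong (_+ #inner) #outer ⟨
    count (a + suc q) (P? ∘ outer) + #inner        ∎
    where
    #left  = count a (P? ∘ (_↑ˡ (suc m + suc q)))
    #right = count (suc q) (P? ∘ (a ↑ʳ_) ∘ (suc m ↑ʳ_))
    #inner = count (suc m) (P? ∘ inner)
    #middle : count (suc m + suc q) (P? ∘ (a ↑ʳ_)) ≡ #inner + #right
    #middle = count-+ (suc m) (suc q) (P? ∘ (a ↑ʳ_))
    #outer : count (a + suc q) (P? ∘ outer) ≡ #left + #right
    #outer = trans (count-+ a (suc q) (P? ∘ outer))
                   (cong₂ _+_ (count-∘-cong a P? outer-↑ˡ) (count-∘-cong (suc q) P? outer-↑ʳ))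

  toℕ-outer-< : ∀ x → toℕ x < a → toℕ (outer x) ≡ toℕ x
  toℕ-outer-< x x<a with split a (suc q) x
  ... | left i  = trans (cong toℕ (outer-↑ˡ i)) (trans (toℕ-↑ˡ i _) (sym (toℕ-↑ˡ i _)))
  ... | right j = ⊥-elim (ℕ.<⇒≱ x<a (subst (a ≤_) (sym (toℕ-↑ʳ a j)) (ℕ.m≤m+n a _)))

  toℕ-outer-≥ : ∀ x → a ≤ toℕ x → toℕ (outer x) ≡ suc m + toℕ x
  toℕ-outer-≥ x a≤x with split a (suc q) x
  ... | left i  = ⊥-elim (ℕ.<⇒≱ (subst (_< a) (sym (toℕ-↑ˡ i _)) (toℕ<n i)) a≤x)
  ... | right j = begin
    toℕ (outer (a ↑ʳ j))     ≡⟨ cong toℕ (outer-↑ʳ j) ⟩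
    toℕ (a ↑ʳ (suc m ↑ʳ j))  ≡⟨ trans (toℕ-↑ʳ a _) (cong (a +_) (toℕ-↑ʳ (suc m) j)) ⟩
    a + (suc m + toℕ j)      ≡⟨ x∙yz≈y∙xz a (suc m) (toℕ j) ⟩
    suc m + (a + toℕ j)      ≡⟨ cong (suc m +_) (toℕ-↑ʳ a j) ⟨
    suc m + toℕ (a ↑ʳ j)     ∎

  toℕ≤toℕ-outer : ∀ x → toℕ x ≤ toℕ (outer x)
  toℕ≤toℕ-outer x with toℕ x ℕ.<? a
  ... | yes x<a = ℕ.≤-reflexive (sym (toℕ-outer-< x x<a))
  ... | no x≮a  = subst (toℕ x ≤_) (sym (toℕ-outer-≥ x (ℕ.≮⇒≥ x≮a))) (ℕ.m≤n+m (toℕ x) (suc m))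

  toℕ-inner : ∀ k → toℕ (inner k) ≡ a + toℕ k
  toℕ-inner k = trans (toℕ-↑ʳ a _) (cong (a +_) (toℕ-↑ˡ k _))

  toℕ-inner-zero : toℕ (inner zero) ≡ a
  toℕ-inner-zero = trans (toℕ-inner zero) (+-identityʳ a)

  toℕ-pivot : toℕ pivot ≡ a
  toℕ-pivot = trans (toℕ-↑ʳ a zero) (+-identityʳ a)

  outer-last : ∀ x → suc (toℕ x) ≡ a + suc q → suc (toℕ (outer x)) ≡ N
  outer-last x last = begin
    suc (toℕ (outer x))   ≡⟨ cong suc (toℕ-outer-≥ x a≤x) ⟩
    suc (suc m + toℕ x)   ≡⟨ +-suc (suc m) (toℕ x) ⟨
    suc m + suc (toℕ x)   ≡⟨ cong (suc m +_) last ⟩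
    suc m + (a + suc q)   ≡⟨ x∙yz≈y∙xz (suc m) a (suc q) ⟩
    N                     ∎
    where
    a≤x : a ≤ toℕ x
    a≤x = subst (a ≤_) (ℕ.suc-injective (trans (sym (+-suc a q)) (sym last))) (ℕ.m≤m+n a q)

  succ-outer : ∀ x → succ x ≢ pivot → succ (outer x) ≡ outer (succ x)
  succ-outer x succ≢pivot with not-last-or-last x
  ... | inj₂ last =
    succ-wrap (outer-last x last) (trans (toℕ-outer-< (succ x) (subst (_< a) (sym wraps) 0<a)) wraps)
    where
    wraps : toℕ (succ x) ≡ 0
    wraps = toℕ-succ-last x last
    0<a : 0 < a
    0<a = ℕ.n≢0⇒n>0 λ a≡0 → succ≢pivot (toℕ-injective (trans wraps (sym (trans toℕ-pivot a≡0))))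
  ... | inj₁ not-last with toℕ x ℕ.<? a
  ...   | yes x<a = succ-step (begin
    toℕ (outer (succ x))  ≡⟨ toℕ-outer-< (succ x) (subst (_< a) (sym steps) sx<a) ⟩
    toℕ (succ x)          ≡⟨ steps ⟩
    suc (toℕ x)           ≡⟨ cong suc (toℕ-outer-< x x<a) ⟨
    suc (toℕ (outer x))   ∎)
    where
    steps = toℕ-succ-< x not-last
    sx<a : suc (toℕ x) < a
    sx<a = ℕ.≤∧≢⇒< x<a λ sx≡a → succ≢pivot (toℕ-injective (trans steps (trans sx≡a (sym toℕ-pivot))))
  ...   | no x≮a = succ-step (begin
    toℕ (outer (succ x))  ≡⟨ toℕ-outer-≥ (succ x) (subst (a ≤_) (sym steps) (ℕ.m≤n⇒m≤1+n (ℕ.≮⇒≥ x≮a))) ⟩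
    suc m + toℕ (succ x)  ≡⟨ cong (suc m +_) steps ⟩
    suc m + suc (toℕ x)   ≡⟨ +-suc (suc m) (toℕ x) ⟩
    suc (suc m + toℕ x)   ≡⟨ cong suc (toℕ-outer-≥ x (ℕ.≮⇒≥ x≮a)) ⟨
    suc (toℕ (outer x))   ∎)
    where
    steps = toℕ-succ-< x not-last

  succ-outer-pivot : ∀ x → succ x ≡ pivot → succ (outer x) ≡ inner zero
  succ-outer-pivot x succ≡pivot with not-last-or-last x
  ... | inj₂ last = succ-wrap (outer-last x last) (begin
    toℕ (inner zero)  ≡⟨ toℕ-inner-zero ⟩
    a                 ≡⟨ toℕ-pivot ⟨
    toℕ pivot         ≡⟨ cong toℕ succ≡pivot ⟨
    toℕ (succ x)      ≡⟨ toℕ-succ-last x last ⟩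
    0                 ∎)
  ... | inj₁ not-last = succ-step (begin
    toℕ (inner zero)     ≡⟨ toℕ-inner-zero ⟩
    a                    ≡⟨ sx≡a ⟨
    suc (toℕ x)          ≡⟨ cong suc (toℕ-outer-< x (subst (toℕ x <_) sx≡a (ℕ.n<1+n (toℕ x)))) ⟨
    suc (toℕ (outer x))  ∎)
    where
    sx≡a : suc (toℕ x) ≡ a
    sx≡a = trans (sym (toℕ-succ-< x not-last)) (trans (cong toℕ succ≡pivot) toℕ-pivot)

  succ-inner : ∀ k → succ k ≢ zero → succ (inner k) ≡ inner (succ k)
  succ-inner k succ≢zero with not-last-or-last k
  ... | inj₂ last     = ⊥-elim (succ≢zero (toℕ-injective (toℕ-succ-last k last)))
  ... | inj₁ not-last = succ-step (begin
    toℕ (inner (succ k))  ≡⟨ toℕ-inner (succ k) ⟩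
    a + toℕ (succ k)      ≡⟨ cong (a +_) (toℕ-succ-< k not-last) ⟩
    a + suc (toℕ k)       ≡⟨ +-suc a (toℕ k) ⟩
    suc (a + toℕ k)       ≡⟨ cong suc (toℕ-inner k) ⟨
    suc (toℕ (inner k))   ∎)

  succ-inner-last : ∀ k → succ k ≡ zero → succ (inner k) ≡ outer pivot
  succ-inner-last k succ≡zero with not-last-or-last k
  ... | inj₁ not-last = ⊥-elim (ℕ.1+n≢0 (trans (sym (toℕ-succ-< k not-last)) (cong toℕ succ≡zero)))
  ... | inj₂ last     = succ-step (begin
    toℕ (outer pivot)     ≡⟨ toℕ-outer-≥ pivot (ℕ.≤-reflexive (sym toℕ-pivot)) ⟩
    suc m + toℕ pivot     ≡⟨ cong (suc m +_) toℕ-pivot ⟩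
    suc m + a             ≡⟨ +-comm (suc m) a ⟩
    a + suc m             ≡⟨ cong (a +_) last ⟨
    a + suc (toℕ k)       ≡⟨ +-suc a (toℕ k) ⟩
    suc (a + toℕ k)       ≡⟨ cong suc (toℕ-inner k) ⟨
    suc (toℕ (inner k))   ∎)

involution-avoids-fixed : ∀ {A : Set} (f : A → A) {a x : A} →
  (∀ y → f (f y) ≡ y) → f a ≡ a → x ≢ a → f x ≢ a
involution-avoids-fixed f {x = x} involutive fa≡a x≢a fx≡a =
  x≢a (trans (sym (involutive x)) (trans (cong f fx≡a) fa≡a))

module Insert {a q m f₁ f₂ r₁ r₂ : ℕ} {cs₁ cs₂ : List ℕ}
  (D₁ : ChordDiagram (a + suc q) (suc f₁) cs₁ r₁) (a<r₁ : a < r₁)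
  (D₂ : ChordDiagram (suc m) (suc f₂) cs₂ (suc r₂)) where

  open Layout a q m
  module D₁ = ChordDiagram D₁
  module D₂ = ChordDiagram D₂

  pivot-unmatched : D₁.chord pivot ≡ pivot
  pivot-unmatched = D₁.prefix-unmatched pivot (subst (_< r₁) (sym toℕ-pivot) a<r₁)

  zero-unmatched : D₂.chord zero ≡ zero
  zero-unmatched = D₂.prefix-unmatched zero (s≤s z≤n)

  chord₁ : Fin (a + suc q) → Fin N
  chord₁ x with x Fin.≟ pivot
  ... | yes _ = inner zero
  ... | no _  = outer (D₁.chord x)

  chord₂ : Fin (suc m) → Fin N
  chord₂ zero    = outer pivot
  chord₂ (suc k) = inner (D₂.chord (suc k))

  chord : Fin N → Fin N
  chord y = [ chord₁ , chord₂ ]′ (part y)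

  chord-outer : ∀ x → x ≢ pivot → chord (outer x) ≡ outer (D₁.chord x)
  chord-outer x x≢pivot rewrite part-outer x with x Fin.≟ pivot
  ... | yes x≡pivot = ⊥-elim (x≢pivot x≡pivot)
  ... | no _        = refl

  chord-outer-pivot : chord (outer pivot) ≡ inner zero
  chord-outer-pivot rewrite part-outer pivot with pivot Fin.≟ pivot
  ... | yes _          = refl
  ... | no pivot≢pivot = ⊥-elim (pivot≢pivot refl)

  chord-inner : ∀ k → k ≢ zero → chord (inner k) ≡ inner (D₂.chord k)
  chord-inner zero    k≢zero = ⊥-elim (k≢zero refl)
  chord-inner (suc k) _ rewrite part-inner (suc k) = refl

  chord-inner-zero : chord (inner zero) ≡ outer pivot
  chord-inner-zero rewrite part-inner zero = refl

  chord-involutive : ∀ y → chord (chord y) ≡ y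
  chord-involutive y with side y
  ... | outerˢ x with x Fin.≟ pivot
  ...   | yes refl    = trans (cong chord chord-outer-pivot) chord-inner-zero
  ...   | no x≢pivot  = begin
    chord (chord (outer x))          ≡⟨ cong chord (chord-outer x x≢pivot) ⟩
    chord (outer (D₁.chord x))       ≡⟨ chord-outer (D₁.chord x) partner≢pivot ⟩
    outer (D₁.chord (D₁.chord x))    ≡⟨ cong outer (D₁.chord-involutive x) ⟩
    outer x                          ∎
    where
    partner≢pivot = involution-avoids-fixed D₁.chord D₁.chord-involutive pivot-unmatched x≢pivot
  chord-involutive y | innerˢ k with k Fin.≟ zero
  ...   | yes refl    = trans (cong chord chord-inner-zero) chord-outer-pivot
  ...   | no k≢zero   = begin
    chord (chord (inner k))          ≡⟨ cong chord (chord-inner k k≢zero) ⟩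
    chord (inner (D₂.chord k))       ≡⟨ chord-inner (D₂.chord k) partner≢zero ⟩
    inner (D₂.chord (D₂.chord k))    ≡⟨ cong inner (D₂.chord-involutive k) ⟩
    inner k                          ∎
    where
    partner≢zero = involution-avoids-fixed D₂.chord D₂.chord-involutive zero-unmatched k≢zero

  face-outer : ∀ x → chord (succ (outer x)) ≡ outer (D₁.chord (succ x))
  face-outer x with succ x Fin.≟ pivot
  ... | yes succ≡pivot = begin
    chord (succ (outer x))     ≡⟨ cong chord (succ-outer-pivot x succ≡pivot) ⟩
    chord (inner zero)         ≡⟨ chord-inner-zero ⟩
    outer pivot                ≡⟨ cong outer (trans (cong D₁.chord succ≡pivot) pivot-unmatched) ⟨
    outer (D₁.chord (succ x))  ∎
  ... | no succ≢pivot = trans (cong chord (succ-outer x succ≢pivot)) (chord-outer (succ x) succ≢pivot)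

  face-inner : ∀ k → chord (succ (inner k)) ≡ inner (D₂.chord (succ k))
  face-inner k with succ k Fin.≟ zero
  ... | yes succ≡zero = begin
    chord (succ (inner k))     ≡⟨ cong chord (succ-inner-last k succ≡zero) ⟩
    chord (outer pivot)        ≡⟨ chord-outer-pivot ⟩
    inner zero                 ≡⟨ cong inner (trans (cong D₂.chord succ≡zero) zero-unmatched) ⟨
    inner (D₂.chord (succ k))  ∎
  ... | no succ≢zero = trans (cong chord (succ-inner k succ≢zero)) (chord-inner (succ k) succ≢zero)

  n₁≤N : a + suc q ≤ N
  n₁≤N = ℕ.+-monoʳ-≤ a (ℕ.m≤n+m (suc q) (suc m))

  m≤N : suc m ≤ N
  m≤N = ℕ.≤-trans (ℕ.m≤m+n (suc m) (suc q)) (ℕ.m≤n+m _ a)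

  faces-periodic : ∀ y → ∃ (IsPeriod (chord ∘ succ) y)
  faces-periodic y with side y
  ... | outerˢ x = let L , P = D₁.faces-periodic x
                   in L , IsPeriod-equivariant outer outer-injective face-outer n₁≤N P
  ... | innerˢ k = let L , P = D₂.faces-periodic k
                   in L , IsPeriod-equivariant inner inner-injective face-inner m≤N P

  prefix-unmatched : ∀ y → toℕ y < a → chord y ≡ y
  prefix-unmatched y y<a with side y
  ... | innerˢ k = ⊥-elim (ℕ.<⇒≱ y<a (subst (a ≤_) (sym (toℕ-inner k)) (ℕ.m≤m+n a (toℕ k))))
  ... | outerˢ x = trans (chord-outer x x≢pivot) (cong outer (D₁.prefix-unmatched x (ℕ.<-trans x<a a<r₁)))
    where
    x<a : toℕ x < a
    x<a = ℕ.≤-<-trans (toℕ≤toℕ-outer x) y<a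
    x≢pivot : x ≢ pivot
    x≢pivot x≡pivot = ℕ.<-irrefl (trans (cong toℕ x≡pivot) toℕ-pivot) x<a

  unmatched-outer : count (a + suc q) (λ x → chord (outer x) Fin.≟ outer x) ≡ f₁
  unmatched-outer = ℕ.suc-injective (trans (sym one-less) D₁.unmatched)
    where
    old? = λ x → D₁.chord x Fin.≟ x
    new? = λ x → chord (outer x) Fin.≟ outer x
    one-less : count (a + suc q) old? ≡ suc (count (a + suc q) new?)
    one-less = count-except (a + suc q) old? new? pivot pivot-unmatched
      (λ fixed → outer≢inner pivot zero (trans (sym fixed) chord-outer-pivot))
      (λ x x≢pivot fixed → trans (chord-outer x x≢pivot) (cong outer fixed))
      (λ x x≢pivot fixed → outer-injective (trans (sym (chord-outer x x≢pivot)) fixed))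

  unmatched-inner : count (suc m) (λ k → chord (inner k) Fin.≟ inner k) ≡ f₂
  unmatched-inner = ℕ.suc-injective (trans (sym one-less) D₂.unmatched)
    where
    old? = λ k → D₂.chord k Fin.≟ k
    new? = λ k → chord (inner k) Fin.≟ inner k
    one-less : count (suc m) old? ≡ suc (count (suc m) new?)
    one-less = count-except (suc m) old? new? zero zero-unmatched
      (λ fixed → outer≢inner pivot zero (trans (sym chord-inner-zero) fixed))
      (λ k k≢zero fixed → trans (chord-inner k k≢zero) (cong inner fixed))
      (λ k k≢zero fixed → inner-injective (trans (sym (chord-inner k k≢zero)) fixed))

  census : ∀ ℓ → count N (λ y → period (chord ∘ succ) y ℕ.≟ ℓ) ≡ pointsOn (cs₁ ++ cs₂) ℓ
  census ℓ = begin
    count N (λ y → period (chord ∘ succ) y ℕ.≟ ℓ)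
      ≡⟨ count-split (λ y → period (chord ∘ succ) y ℕ.≟ ℓ) ⟩
    count (a + suc q) (λ x → period (chord ∘ succ) (outer x) ℕ.≟ ℓ)
      + count (suc m) (λ k → period (chord ∘ succ) (inner k) ℕ.≟ ℓ)
      ≡⟨ cong₂ _+_ (count-level-cong _ period-outer ℓ) (count-level-cong _ period-inner ℓ) ⟩
    count (a + suc q) (λ x → period (D₁.chord ∘ succ) x ℕ.≟ ℓ)
      + count (suc m) (λ k → period (D₂.chord ∘ succ) k ℕ.≟ ℓ)
      ≡⟨ cong₂ _+_ (D₁.census ℓ) (D₂.census ℓ) ⟩
    pointsOn cs₁ ℓ + pointsOn cs₂ ℓ
      ≡⟨ pointsOn-++ cs₁ cs₂ ℓ ⟨
    pointsOn (cs₁ ++ cs₂) ℓ ∎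
    where
    period-outer : ∀ x → period (chord ∘ succ) (outer x) ≡ period (D₁.chord ∘ succ) x
    period-outer x = period-equivariant outer outer-injective face-outer n₁≤N (D₁.faces-periodic x)
    period-inner : ∀ k → period (chord ∘ succ) (inner k) ≡ period (D₂.chord ∘ succ) k
    period-inner k = period-equivariant inner inner-injective face-inner m≤N (D₂.faces-periodic k)

  diagram : ChordDiagram N (f₁ + f₂) (cs₁ ++ cs₂) a
  diagram = record
    { chord            = chord
    ; chord-involutive = chord-involutive
    ; prefix≤n         = ℕ.m≤m+n a _
    ; prefix-unmatched = prefix-unmatched
    ; faces-periodic   = faces-periodic
    ; unmatched        = trans (count-split (λ y → chord y Fin.≟ y))
                               (cong₂ _+_ unmatched-outer unmatched-inner)
    ; census           = census
    }

insert : ∀ {f₁ f₂ cs₁ cs₂ r₁ r₂} p → Diagram (suc f₁) cs₁ r₁ → p < r₁ → Diagram (suc f₂) cs₂ (suc r₂) →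
  Diagram (f₁ + f₂) (cs₁ ++ cs₂) p
insert p (n₁ , D₁) p<r₁ (n₂ , D₂) =
  n₂ + suc n₁ , resize inserted-size (Insert.diagram (resize split-size D₁) p<r₁ D₂)
  where
  q = n₁ ∸ p
  p≤n₁ : p ≤ n₁
  p≤n₁ = ℕ.≤-pred (ℕ.<-≤-trans p<r₁ (ChordDiagram.prefix≤n D₁))
  split-size : suc n₁ ≡ p + suc q
  split-size = sym (trans (+-suc p q) (cong suc (ℕ.m+[n∸m]≡n p≤n₁)))
  inserted-size : p + (suc n₂ + suc q) ≡ suc n₂ + suc n₁
  inserted-size = trans (x∙yz≈y∙xz p (suc n₂) (suc q)) (cong (suc n₂ +_) (sym split-size))

-- Diagrams with prescribed faces

face : ∀ r e → Diagram (suc r) (suc r + e ∷ replicate e 1) (suc r)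
face r zero    = retype refl (↭-reflexive (cong [_] (sym (+-identityʳ (suc r))))) ℕ.≤-refl (r , polygon r)
face r (suc e) =
  retype (+-identityʳ (suc r)) faces ℕ.≤-refl (insert (suc r) (face (suc r) e) ℕ.≤-refl leaf)
  where
  faces : (suc (suc r) + e ∷ replicate e 1) ++ [ 1 ] ↭ suc r + suc e ∷ replicate (suc e) 1
  faces = ↭-trans (prep _ (↭-sym (∷↭∷ʳ 1 (replicate e 1))))
                  (↭-reflexive (cong (λ c → suc c ∷ replicate (suc e) 1) (sym (+-suc r e))))

-- The first face of a chain has l + 2 sides and takes e ≤ l leaves, keeping a second
-- unmatched point for the rest of the chain, which takes the other a′ leaves.
split-leaves : ∀ l T f a → f + a ≡ suc (l + T) →
  ∃₂ λ d e → ∃₂ λ f′ a′ → l ≡ d + e × a ≡ e + a′ × f ≡ d + f′ × f′ + a′ ≡ suc T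
split-leaves zero    T f a       eq = 0 , 0 , f , a , refl , refl , refl , eq
split-leaves (suc l) T f zero    eq =
  suc l , 0 , suc T , 0 , sym (+-identityʳ (suc l)) , refl ,
  trans (sym (+-identityʳ f)) (trans eq (sym (+-suc (suc l) T))) , +-identityʳ (suc T)
split-leaves (suc l) T f (suc a) eq
  with split-leaves l T f a (ℕ.suc-injective (trans (sym (+-suc f a)) eq))
... | d , e , f′ , a′ , l≡d+e , a≡e+a′ , f≡d+f′ , eq′ =
  d , suc e , f′ , a′ , trans (cong suc l≡d+e) (sym (+-suc d e)) , cong suc a≡e+a′ , f≡d+f′ , eq′

replicate-++ : ∀ {A : Set} m n (x : A) ys →
  replicate m x ++ replicate n x ++ ys ≡ replicate (m + n) x ++ ys
replicate-++ zero    n x ys = refl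
replicate-++ (suc m) n x ys = cong (x ∷_) (replicate-++ m n x ys)

chain : ∀ l ls f a → f + a ≡ suc (sum (l ∷ ls)) →
  Diagram (suc f) (replicate a 1 ++ map (2 +_) (l ∷ ls)) 1
chain l [] f a eq = retype refl faces (s≤s z≤n) (face f a)
  where
  faces : suc f + a ∷ replicate a 1 ↭ replicate a 1 ++ [ 2 + l ]
  faces = ↭-trans (↭-reflexive (cong (λ c → suc c ∷ replicate a 1) (trans eq (cong suc (+-identityʳ l)))))
                  (∷↭∷ʳ (2 + l) (replicate a 1))
chain l (l′ ∷ ls) f a eq with split-leaves l (sum (l′ ∷ ls)) f a eq
... | d , e , f′ , a′ , refl , refl , refl , eq′ =
  retype refl faces ℕ.≤-refl (insert 1 (face (suc d) e) (s≤s (s≤s z≤n)) (chain l′ ls f′ a′ eq′))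
  where
  rest = map (2 +_) (l′ ∷ ls)
  faces : (2 + (d + e) ∷ replicate e 1) ++ replicate a′ 1 ++ rest
          ↭ replicate (e + a′) 1 ++ 2 + (d + e) ∷ rest
  faces = ↭-trans (↭-reflexive (cong (2 + (d + e) ∷_) (replicate-++ e a′ 1 rest)))
                  (↭-sym (shift (2 + (d + e)) (replicate (e + a′) 1) rest))

realise⁺ : ∀ f a ls → suc f + a ≡ 2 + sum ls → 0 < a + length ls →
  Diagram (suc f) (replicate a 1 ++ map (2 +_) ls) 1
realise⁺ f       a             (l ∷ ls) eq _  = chain l ls f a (ℕ.suc-injective eq)
realise⁺ zero    (suc zero)    []       _  _  = leaf
realise⁺ (suc f) (suc a)       []       eq _  = ⊥-elim (ℕ.m+1+n≢0 f (ℕ.suc-injective (ℕ.suc-injective eq)))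
realise⁺ (suc f) zero          []       _  ()
realise⁺ zero    zero          []       () _
realise⁺ zero    (suc (suc a)) []       () _

realise : ∀ f a ls → f + a ≡ 2 + sum ls → 0 < a + length ls →
  Diagram f (replicate a 1 ++ map (2 +_) ls) 0
realise (suc f) a       ls eq nonempty = retype refl ↭-refl z≤n (realise⁺ f a ls eq nonempty)
realise zero    zero    ls () _
realise zero    (suc a) ls eq _        =
  retype refl (↭-sym (∷↭∷ʳ 1 _)) z≤n (insert 0 (realise⁺ zero a ls eq 0<a) (s≤s z≤n) leaf)
  where
  0<a : 0 < a + length ls
  0<a = ℕ.≤-trans (subst (0 <_) (sym (ℕ.suc-injective eq)) (s≤s z≤n)) (ℕ.m≤m+n a (length ls))

-- The square-tiled surface of a chord diagram

module Surface {n f cs r} (D : ChordDiagram (suc n) f cs r) where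
  open ChordDiagram D

  surface : Triple (suc n)
  surface = triple chord neg opposite

  shiftWord : ℕ → List Colour
  shiftWord zero    = []
  shiftWord (suc j) = G ∷ B ∷ shiftWord j

  shiftWord-GB : ∀ j → OnlyGB (shiftWord j)
  shiftWord-GB zero    = tt
  shiftWord-GB (suc j) = shiftWord-GB j

  applyWord-shiftWord : ∀ j x → applyWord surface (shiftWord j) x ≡ iter succ j x
  applyWord-shiftWord zero    x = refl
  applyWord-shiftWord (suc j) x = cong succ (applyWord-shiftWord j x)

  connected : OneGBComponent surface
  connected x y = shiftWord j , shiftWord-GB j , trans (applyWord-shiftWord j x) (succ-reaches x y)
    where j = suc n ∸ toℕ x + toℕ y

  squareTiled : IsSquareTiled (suc n) surface
  squareTiled = chord-involutive , neg-involutive , opposite-involutive ,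
                λ x y → let w , _ , w-x≡y = connected x y in w , w-x≡y

  pathLike : PathLike surface
  pathLike = connected , zero , inj₁ refl

  fixed : totalFixed surface ≡ f + 2
  fixed = begin
    fixedPoints chord + fixedPoints {suc n} neg + fixedPoints {suc n} opposite
      ≡⟨ cong₂ _+_ (cong₂ _+_ (length-filter-allFin (suc n) chord?) (length-filter-allFin (suc n) neg?))
                   (length-filter-allFin (suc n) opposite?) ⟩
    count (suc n) chord? + count (suc n) neg? + count (suc n) opposite?
      ≡⟨ +-assoc (count (suc n) chord?) _ _ ⟩
    count (suc n) chord? + (count (suc n) neg? + count (suc n) opposite?)
      ≡⟨ cong₂ _+_ unmatched (negFixed+oppositeFixed n) ⟩
    f + 2 ∎
    where
    chord?    = λ x → chord x Fin.≟ x
    neg?      = λ (x : Fin (suc n)) → neg x Fin.≟ x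
    opposite? = λ (x : Fin (suc n)) → opposite x Fin.≟ x

  points : ∀ ℓ → pointsOnCyclesOfLength (product surface) ℓ ≡ pointsOn cs ℓ
  points ℓ = trans (length-filter-allFin (suc n) (λ x → period (product surface) x ℕ.≟ ℓ)) (census ℓ)

-- Cycle types and the spherical condition

-- lengthsFrom 1 μ lists the cycle lengths of type μ: length suc i occurs mult μ i times.
lengthsFrom : ℕ → List ℕ → List ℕ
lengthsFrom s []       = []
lengthsFrom s (m ∷ ms) = replicate m s ++ lengthsFrom (suc s) ms

pointsOn-replicate : ∀ m {b ℓ} → b ≡ ℓ → pointsOn (replicate m b) ℓ ≡ m * ℓ
pointsOn-replicate zero    b≡ℓ = refl
pointsOn-replicate (suc m) b≡ℓ = trans (pointsOn-here _ b≡ℓ) (cong₂ _+_ b≡ℓ (pointsOn-replicate m b≡ℓ))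

pointsOn-replicate-≢ : ∀ m {b ℓ} → b ≢ ℓ → pointsOn (replicate m b) ℓ ≡ 0
pointsOn-replicate-≢ zero    b≢ℓ = refl
pointsOn-replicate-≢ (suc m) b≢ℓ = trans (pointsOn-there _ b≢ℓ) (pointsOn-replicate-≢ m b≢ℓ)

pointsOn-lengthsFrom-< : ∀ {s ℓ} ms → ℓ < s → pointsOn (lengthsFrom s ms) ℓ ≡ 0
pointsOn-lengthsFrom-< []       ℓ<s = refl
pointsOn-lengthsFrom-< (m ∷ ms) ℓ<s =
  trans (pointsOn-++ (replicate m _) _ _)
        (cong₂ _+_ (pointsOn-replicate-≢ m λ s≡ℓ → ℕ.<-irrefl (sym s≡ℓ) ℓ<s)
                   (pointsOn-lengthsFrom-< ms (ℕ.m<n⇒m<1+n ℓ<s)))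

pointsOn-lengthsFrom : ∀ s ms i → pointsOn (lengthsFrom s ms) (s + i) ≡ mult ms i * (s + i)
pointsOn-lengthsFrom s []       i       = refl
pointsOn-lengthsFrom s (m ∷ ms) zero    = begin
  pointsOn (replicate m s ++ lengthsFrom (suc s) ms) (s + 0)
    ≡⟨ pointsOn-++ (replicate m s) _ (s + 0) ⟩
  pointsOn (replicate m s) (s + 0) + pointsOn (lengthsFrom (suc s) ms) (s + 0)
    ≡⟨ cong₂ _+_ (pointsOn-replicate m (sym (+-identityʳ s)))
                 (pointsOn-lengthsFrom-< ms (s≤s (ℕ.≤-reflexive (+-identityʳ s)))) ⟩
  m * (s + 0) + 0
    ≡⟨ +-identityʳ _ ⟩
  m * (s + 0) ∎
pointsOn-lengthsFrom s (m ∷ ms) (suc i) = begin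
  pointsOn (replicate m s ++ lengthsFrom (suc s) ms) (s + suc i)
    ≡⟨ pointsOn-++ (replicate m s) _ (s + suc i) ⟩
  pointsOn (replicate m s) (s + suc i) + pointsOn (lengthsFrom (suc s) ms) (s + suc i)
    ≡⟨ cong₂ _+_ (pointsOn-replicate-≢ m (λ s≡ → ℕ.m≢1+m+n s (trans s≡ (+-suc s i))))
                 (cong (pointsOn (lengthsFrom (suc s) ms)) (+-suc s i)) ⟩
  pointsOn (lengthsFrom (suc s) ms) (suc s + i)
    ≡⟨ pointsOn-lengthsFrom (suc s) ms i ⟩
  mult ms i * (suc s + i)
    ≡⟨ cong (mult ms i *_) (+-suc s i) ⟨
  mult ms i * (s + suc i) ∎

cyclesOfLength-lengthsFrom : ∀ {n} (σ : Fin n → Fin n) μ →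
  (∀ ℓ → pointsOnCyclesOfLength σ ℓ ≡ pointsOn (lengthsFrom 1 μ) ℓ) →
  ∀ i → cyclesOfLength σ i ≡ mult μ i
cyclesOfLength-lengthsFrom σ μ points i =
  trans (cong (_/ suc i) (trans (points (suc i)) (pointsOn-lengthsFrom 1 μ i)))
        (m*n/n≡m (mult μ i) (suc i))

map-lengthsFrom : ∀ s ms → map (2 +_) (lengthsFrom s ms) ≡ lengthsFrom (2 + s) ms
map-lengthsFrom s []       = refl
map-lengthsFrom s (m ∷ ms) = trans (map-++ (2 +_) (replicate m s) _)
                                   (cong₂ _++_ (map-replicate (2 +_) m s) (map-lengthsFrom (suc s) ms))

length-lengthsFrom : ∀ s ms → length (lengthsFrom s ms) ≡ sum ms
length-lengthsFrom s []       = refl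
length-lengthsFrom s (m ∷ ms) =
  trans (length-++ (replicate m s)) (cong₂ _+_ (length-replicate m) (length-lengthsFrom (suc s) ms))

mult≤sum : ∀ ms i → mult ms i ≤ sum ms
mult≤sum []       i       = z≤n
mult≤sum (m ∷ ms) zero    = ℕ.m≤m+n m (sum ms)
mult≤sum (m ∷ ms) (suc i) = ℕ.≤-trans (mult≤sum ms i) (ℕ.m≤n+m (sum ms) m)

sum-replicate : ∀ m s → sum (replicate m s) ≡ m * s
sum-replicate zero    s = refl
sum-replicate (suc m) s = cong (s +_) (sum-replicate m s)

sphSumFrom-lengthsFrom : ∀ s ms → sphSumFrom (2 + s) ms ≡ ℤ.+ sum (lengthsFrom s ms)
sphSumFrom-lengthsFrom s []       = refl
sphSumFrom-lengthsFrom s (m ∷ ms) = begin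
  ℤ.+ m ℤ.* ℤ.+ s ℤ.+ sphSumFrom (3 + s) ms
    ≡⟨ cong₂ ℤ._+_ (sym (ℤ.pos-* m s)) (sphSumFrom-lengthsFrom (suc s) ms) ⟩
  ℤ.+ (m * s) ℤ.+ ℤ.+ sum (lengthsFrom (suc s) ms)
    ≡⟨ ℤ.pos-+ (m * s) _ ⟨
  ℤ.+ (m * s + sum (lengthsFrom (suc s) ms))
    ≡⟨ cong (λ t → ℤ.+ (t + sum (lengthsFrom (suc s) ms))) (sum-replicate m s) ⟨
  ℤ.+ (sum (replicate m s) + sum (lengthsFrom (suc s) ms))
    ≡⟨ cong ℤ.+_ (sum-++ (replicate m s) _) ⟨
  ℤ.+ sum (replicate m s ++ lengthsFrom (suc s) ms) ∎

spherical⇒unmatched : ∀ a rest f → Spherical (a ∷ rest) (2 + f) → f + a ≡ 2 + sum (lengthsFrom 0 rest)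
spherical⇒unmatched a rest f spherical = ℕ.suc-injective (ℕ.suc-injective (ℤ.+-injective (begin
  ℤ.+ (k + a)                                    ≡⟨ ℤ.pos-+ k a ⟩
  ℤ.+ k ℤ.+ ℤ.+ a                                ≡⟨ regroup (ℤ.+ k) (ℤ.+ a) ⟩
  (ℤ.+ k ℤ.- ℤ.+ 4) ℤ.+ (ℤ.+ 4 ℤ.+ ℤ.+ a)        ≡⟨ cong (ℤ._+ (ℤ.+ 4 ℤ.+ ℤ.+ a)) spherical ⟨
  sphSum (a ∷ rest) ℤ.+ (ℤ.+ 4 ℤ.+ ℤ.+ a)        ≡⟨ cong (λ t → A ℤ.+ t ℤ.+ (ℤ.+ 4 ℤ.+ ℤ.+ a))
                                                      (sphSumFrom-lengthsFrom 0 rest) ⟩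
  A ℤ.+ ℤ.+ T ℤ.+ (ℤ.+ 4 ℤ.+ ℤ.+ a)              ≡⟨ cancel (ℤ.+ a) (ℤ.+ T) ⟩
  ℤ.+ 4 ℤ.+ ℤ.+ T                                ≡⟨ ℤ.pos-+ 4 T ⟨
  ℤ.+ (4 + T)                                    ∎)))
  where
  k = 2 + f
  T = sum (lengthsFrom 0 rest)
  A = ℤ.+ a ℤ.* (ℤ.+ 1 ℤ.- ℤ.+ 2)
  regroup : ∀ K A → K ℤ.+ A ≡ (K ℤ.- ℤ.+ 4) ℤ.+ (ℤ.+ 4 ℤ.+ A)
  regroup = ℤ-Ring.solve-∀
  cancel : ∀ A T → A ℤ.* (ℤ.+ 1 ℤ.- ℤ.+ 2) ℤ.+ T ℤ.+ (ℤ.+ 4 ℤ.+ A) ≡ ℤ.+ 4 ℤ.+ T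
  cancel = ℤ-Ring.solve-∀

nonempty⇒positive : ∀ a rest → NonemptyType (a ∷ rest) → 0 < a + length (lengthsFrom 0 rest)
nonempty⇒positive a rest (i , 1≤mult) = ℕ.≤-trans 1≤mult
  (subst (mult (a ∷ rest) i ≤_) (cong (a +_) (sym (length-lengthsFrom 0 rest))) (mult≤sum (a ∷ rest) i))

theorem3p1 : (μ : List ℕ) (k : ℕ) → NonemptyType μ → Spherical μ k → 2 ≤ k →
    Σ ℕ λ n → Σ (Triple n) λ t → IsSquareTiled n t × HasProfile t μ k × PathLike t
theorem3p1 []         k       (_ , ()) _ _
theorem3p1 (a ∷ rest) .(2 + f) nonempty spherical (s≤s (s≤s {n = f} _))
  with realise f a (lengthsFrom 0 rest) (spherical⇒unmatched a rest f spherical)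
                                        (nonempty⇒positive a rest nonempty)
... | n , D = suc n , surface , squareTiled , (profile , trans fixed (+-comm f 2)) , pathLike
  where
  open Surface D
  profile : ∀ i → cyclesOfLength (product surface) i ≡ mult (a ∷ rest) i
  profile = cyclesOfLength-lengthsFrom (product surface) (a ∷ rest) λ ℓ →
    trans (points ℓ) (cong (λ ls → pointsOn (replicate a 1 ++ ls) ℓ) (map-lengthsFrom 0 rest))
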